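{- Let $B\ge 2$, and let $n=4$ if $2\le B\le 6$ and $n=3$ if $B\ge 7$. Every cycle of $S_B$ contains a point $g=a+bi$ with $|a|<B^n$ and $|b|<B^n$. In particular, every fixed point $g=a+bi$ of $S_B$ satisfies $|a|<B^n$ and $|b|<B^n$.
   Context: Fix an integer $B\ge 2$. Every nonzero Gaussian integer $a+bi$ is written uniquely as $a+bi=\sum_{j=0}^n (a_j+b_ji)B^j$ with $a_j,b_j\in\mathbb{Z}$, $a_n,b_n$ not both $0$, and for each $j$: $|a_j|\le B-1$, $|b_j|\le B-1$, $\operatorname{sgn}(a)a_j\ge 0$, $\operatorname{sgn}(b)b_j\ge 0$. The Gaussian $B$-happy function $S_B:\mathbb{Z}[i]\to\mathbb{Z}[i]$ is defined by $S_B(0)=0$ and $S_B(a+bi)=\sum_{j=0}^n (a_j+b_ji)^2$. A cycle of $S_B$ is a finite set $\{g_0,\dots,g_{k-1}\}\subset\mathbb{Z}[i]$ ($k\ge1$) with $S_B(g_j)=g_{j+1}$ for $0\le j<k-1$ and $S_B(g_{k-1})=g_0$; a fixed point is a $g$ with $S_B(g)=g$. -}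

module Defs where

open import Data.Nat as ℕ using (ℕ; zero; suc; _%_; _/_; _≤ᵇ_)
open import Data.Integer as ℤ using (ℤ; +_; -[1+_]; _+_; _*_; -_; _-_)
open import Data.List using (List; []; _∷_; map)
open import Data.Bool using (if_then_else_)
open import Data.Product using (_×_; _,_)

record ℤ[i] : Set where
  constructor mkG
  field
    re : ℤ
    im : ℤ
open ℤ[i] public

0ᵍ : ℤ[i]
0ᵍ = mkG (+ 0) (+ 0)

_+ᵍ_ : ℤ[i] → ℤ[i] → ℤ[i]
mkG a b +ᵍ mkG c d = mkG (a + c) (b + d)

_*ᵍ_ : ℤ[i] → ℤ[i] → ℤ[i]
mkG a b *ᵍ mkG c d = mkG (a * c - b * d) (a * d + b * c)

sqᵍ : ℤ[i] → ℤ[i]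
sqᵍ g = g *ᵍ g

sumᵍ : List ℤ[i] → ℤ[i]
sumᵍ [] = 0ᵍ
sumᵍ (g ∷ gs) = g +ᵍ sumᵍ gs

-- Base-B digits of a natural number, least significant first
-- (no leading zeros; digits of 0 is the empty list).  The fuel
-- argument (initialised to m itself) suffices since m / B < m for B ≥ 2.
-- Only meaningful for B ≥ 2; for B < 2 it returns [] (never used).
digitsFuel : ℕ → ℕ → ℕ → List ℕ
digitsFuel zero B m = []
digitsFuel (suc f) (suc (suc k)) zero = []
digitsFuel (suc f) (suc (suc k)) (suc m) =
  (suc m % suc (suc k)) ∷ digitsFuel f (suc (suc k)) (suc m / suc (suc k))
digitsFuel (suc f) _ _ = []

digitsℕ : ℕ → ℕ → List ℕ
digitsℕ B m = digitsFuel m B m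

-- Signed digits of an integer a: a_j with |a_j| ≤ B-1 and sgn(a) a_j ≥ 0.
digitsℤ : ℕ → ℤ → List ℤ
digitsℤ B (+ m) = map +_ (digitsℕ B m)
digitsℤ B -[1+ m ] = map (λ d → - (+ d)) (digitsℕ B (suc m))

zipPad : List ℤ → List ℤ → List ℤ[i]
zipPad [] [] = []
zipPad [] (b ∷ bs) = mkG (+ 0) b ∷ zipPad [] bs
zipPad (a ∷ as) [] = mkG a (+ 0) ∷ zipPad as []
zipPad (a ∷ as) (b ∷ bs) = mkG a b ∷ zipPad as bs

gdigits : ℕ → ℤ[i] → List ℤ[i]
gdigits B (mkG a b) = zipPad (digitsℤ B a) (digitsℤ B b)

S : ℕ → ℤ[i] → ℤ[i]
S B g = sumᵍ (map sqᵍ (gdigits B g))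

iter : ℕ → (ℤ[i] → ℤ[i]) → ℤ[i] → ℤ[i]
iter zero f x = x
iter (suc k) f x = f (iter k f x)

expo : ℕ → ℕ
expo B = if B ≤ᵇ 6 then 4 else 3

{-# OPTIONS --safe #-}
-- Let the height of a + bi be max(|a|, |b|).  Both parts of S_B(a + bi) are
-- bounded in absolute value by the sum of the squared digits of |a| and |b|,
-- which grows only linearly in the number of digits, so S_B strictly lowers
-- every height ≥ B^n.  Along a cycle the height cannot decrease at every step,
-- so some point of the cycle has height < B^n.
module Submission where

open import Defs

open import Data.Empty using (⊥-elim)
open import Data.Integer as ℤ using (ℤ; -[1+_]; ∣_∣)
open import Data.Integer.Properties using (∣i+j∣≤∣i∣+∣j∣; ∣i-j∣≤∣i∣+∣j∣; ∣i*j∣≡∣i∣*∣j∣; ∣-i∣≡∣i∣)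
open import Data.List using (List; []; _∷_; map)
open import Data.List.Properties using (map-∘; map-cong; map-id)
open import Data.Nat using (ℕ; suc; zero; _+_; _*_; _^_; _⊔_; _%_; _/_; _≤_; _<_; z≤n; s≤s; s≤s⁻¹; _<?_; NonZero)
open import Data.Nat.DivMod using (m%n<n; m<n*o⇒m/o<n)
open import Data.Nat.ListAction using (sum)
open import Data.Nat.Properties
open import Data.Nat.Tactic.RingSolver using (solve-∀)
open import Data.Product using (_×_; _,_; ∃-syntax)
open import Data.Sum using (inj₁; inj₂)
open import Function using (_∘_)
open import Relation.Binary.PropositionalEquality using (_≡_; refl; sym; trans; cong; cong₂; subst; subst₂)
open import Relation.Nullary using (yes; no)
open import Algebra.Properties.CommutativeSemigroup +-commutativeSemigroup using (interchange)

sumOfSquares : List ℕ → ℕ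
sumOfSquares ds = sum (map (λ d → d * d) ds)

norm : ℤ[i] → ℕ
norm (mkG a b) = ∣ a ∣ * ∣ a ∣ + ∣ b ∣ * ∣ b ∣

height : ℤ[i] → ℕ
height g = ∣ re g ∣ ⊔ ∣ im g ∣

m≤n⇒m*n+n*m≤m*m+n*n : ∀ {a b} → a ≤ b → a * b + b * a ≤ a * a + b * b
m≤n⇒m*n+n*m≤m*m+n*n {a} a≤b with m≤n⇒∃[o]m+o≡n a≤b
... | o , refl = subst (a * (a + o) + (a + o) * a ≤_) (identity a o) (m≤m+n _ (o * o))
  where
  identity : ∀ a o → a * (a + o) + (a + o) * a + o * o ≡ a * a + (a + o) * (a + o)
  identity = solve-∀

m*n+n*m≤m*m+n*n : ∀ a b → a * b + b * a ≤ a * a + b * b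
m*n+n*m≤m*m+n*n a b with ≤-total a b
... | inj₁ a≤b = m≤n⇒m*n+n*m≤m*m+n*n a≤b
... | inj₂ b≤a = subst₂ _≤_ (+-comm (b * a) (a * b)) (+-comm (b * b) (a * a))
                        (m≤n⇒m*n+n*m≤m*m+n*n b≤a)

∣re-sqᵍ∣≤norm : ∀ g → ∣ re (sqᵍ g) ∣ ≤ norm g
∣re-sqᵍ∣≤norm (mkG a b) = begin
  ∣ a ℤ.* a ℤ.- b ℤ.* b ∣   ≤⟨ ∣i-j∣≤∣i∣+∣j∣ (a ℤ.* a) (b ℤ.* b) ⟩
  ∣ a ℤ.* a ∣ + ∣ b ℤ.* b ∣ ≡⟨ cong₂ _+_ (∣i*j∣≡∣i∣*∣j∣ a a) (∣i*j∣≡∣i∣*∣j∣ b b) ⟩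
  norm (mkG a b)            ∎
  where open ≤-Reasoning

∣im-sqᵍ∣≤norm : ∀ g → ∣ im (sqᵍ g) ∣ ≤ norm g
∣im-sqᵍ∣≤norm (mkG a b) = begin
  ∣ a ℤ.* b ℤ.+ b ℤ.* a ∣       ≤⟨ ∣i+j∣≤∣i∣+∣j∣ (a ℤ.* b) (b ℤ.* a) ⟩
  ∣ a ℤ.* b ∣ + ∣ b ℤ.* a ∣     ≡⟨ cong₂ _+_ (∣i*j∣≡∣i∣*∣j∣ a b) (∣i*j∣≡∣i∣*∣j∣ b a) ⟩
  ∣ a ∣ * ∣ b ∣ + ∣ b ∣ * ∣ a ∣ ≤⟨ m*n+n*m≤m*m+n*n ∣ a ∣ ∣ b ∣ ⟩
  norm (mkG a b)                ∎
  where open ≤-Reasoning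

∣re-sumᵍ-sqᵍ∣≤ : ∀ gs → ∣ re (sumᵍ (map sqᵍ gs)) ∣ ≤ sum (map norm gs)
∣re-sumᵍ-sqᵍ∣≤ []       = z≤n
∣re-sumᵍ-sqᵍ∣≤ (g ∷ gs) = ≤-trans (∣i+j∣≤∣i∣+∣j∣ (re (sqᵍ g)) _)
                                  (+-mono-≤ (∣re-sqᵍ∣≤norm g) (∣re-sumᵍ-sqᵍ∣≤ gs))

∣im-sumᵍ-sqᵍ∣≤ : ∀ gs → ∣ im (sumᵍ (map sqᵍ gs)) ∣ ≤ sum (map norm gs)
∣im-sumᵍ-sqᵍ∣≤ []       = z≤n
∣im-sumᵍ-sqᵍ∣≤ (g ∷ gs) = ≤-trans (∣i+j∣≤∣i∣+∣j∣ (im (sqᵍ g)) _)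
                                  (+-mono-≤ (∣im-sqᵍ∣≤norm g) (∣im-sumᵍ-sqᵍ∣≤ gs))

sum-norm-zipPad : ∀ xs ys →
  sum (map norm (zipPad xs ys)) ≡ sumOfSquares (map ∣_∣ xs) + sumOfSquares (map ∣_∣ ys)
sum-norm-zipPad []       []       = refl
sum-norm-zipPad []       (b ∷ bs) =
  cong (∣ b ∣ * ∣ b ∣ +_) (sum-norm-zipPad [] bs)
sum-norm-zipPad (a ∷ as) []       =
  trans (cong (norm (mkG a (ℤ.+ 0)) +_) (sum-norm-zipPad as []))
        (interchange (∣ a ∣ * ∣ a ∣) 0 (sumOfSquares (map ∣_∣ as)) 0)
sum-norm-zipPad (a ∷ as) (b ∷ bs) =
  trans (cong (norm (mkG a b) +_) (sum-norm-zipPad as bs))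
        (interchange (∣ a ∣ * ∣ a ∣) (∣ b ∣ * ∣ b ∣)
                     (sumOfSquares (map ∣_∣ as)) (sumOfSquares (map ∣_∣ bs)))

map-∣∣-of-sections : ∀ {f : ℕ → ℤ} → (∀ d → ∣ f d ∣ ≡ d) → ∀ ds → map ∣_∣ (map f ds) ≡ ds
map-∣∣-of-sections ∣f∣≗id ds = trans (sym (map-∘ ds)) (trans (map-cong ∣f∣≗id ds) (map-id ds))

map-∣∣-digitsℤ : ∀ B a → map ∣_∣ (digitsℤ B a) ≡ digitsℕ B ∣ a ∣
map-∣∣-digitsℤ B (ℤ.+ m)    = map-∣∣-of-sections (λ _ → refl) (digitsℕ B m)
map-∣∣-digitsℤ B -[1+ m ]  = map-∣∣-of-sections (∣-i∣≡∣i∣ ∘ ℤ.+_) (digitsℕ B (suc m))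

digitSquareSum : ℕ → ℕ → ℕ
digitSquareSum B m = sumOfSquares (digitsℕ B m)

sum-norm-gdigits : ∀ B g →
  sum (map norm (gdigits B g)) ≡ digitSquareSum B ∣ re g ∣ + digitSquareSum B ∣ im g ∣
sum-norm-gdigits B (mkG a b) =
  trans (sum-norm-zipPad (digitsℤ B a) (digitsℤ B b))
        (cong₂ _+_ (cong sumOfSquares (map-∣∣-digitsℤ B a))
                   (cong sumOfSquares (map-∣∣-digitsℤ B b)))

height-S≤ : ∀ B g → height (S B g) ≤ digitSquareSum B ∣ re g ∣ + digitSquareSum B ∣ im g ∣
height-S≤ B g = subst (height (S B g) ≤_) (sum-norm-gdigits B g)
  (⊔-lub (∣re-sumᵍ-sqᵍ∣≤ (gdigits B g)) (∣im-sumᵍ-sqᵍ∣≤ (gdigits B g)))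

digitSquareSumBound : ℕ → ℕ → ℕ
digitSquareSumBound k L = L * (suc k * suc k)

sumOfSquares-digitsFuel≤ : ∀ k L f m → m < (2 + k) ^ L →
  sumOfSquares (digitsFuel f (2 + k) m) ≤ digitSquareSumBound k L
sumOfSquares-digitsFuel≤ k L       zero    m       _  = z≤n
sumOfSquares-digitsFuel≤ k L       (suc f) zero    _  = z≤n
sumOfSquares-digitsFuel≤ k zero    (suc f) (suc m) (s≤s ())
sumOfSquares-digitsFuel≤ k (suc L) (suc f) (suc m) m<B^1+L =
  +-mono-≤ (*-mono-≤ digit≤ digit≤) (sumOfSquares-digitsFuel≤ k L f (suc m / (2 + k)) quotient<)
  where
  digit≤ : suc m % (2 + k) ≤ suc k
  digit≤ = s≤s⁻¹ (m%n<n (suc m) (2 + k))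
  quotient< : suc m / (2 + k) < (2 + k) ^ L
  quotient< = m<n*o⇒m/o<n (subst (suc m <_) (*-comm (2 + k) ((2 + k) ^ L)) m<B^1+L)

n<m^n : ∀ {B} → 1 < B → ∀ n → n < B ^ n
n<m^n 1<B zero    = s≤s z≤n
n<m^n 1<B (suc n) = ≤-<-trans (n<m^n 1<B n) (^-monoʳ-< _ 1<B (n<1+n n))

power-bracket : ∀ {B M} d L₀ → B ^ L₀ ≤ M → M < B ^ (L₀ + d) →
  ∃[ L ] (L₀ ≤ L × B ^ L ≤ M × M < B ^ suc L)
power-bracket {B} {M} zero    L₀ lo hi =
  ⊥-elim (<⇒≱ (subst (λ e → M < B ^ e) (+-identityʳ L₀) hi) lo)
power-bracket {B} {M} (suc d) L₀ lo hi with M <? B ^ suc L₀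
... | yes M<B^1+L₀ = L₀ , ≤-refl , lo , M<B^1+L₀
... | no  M≮B^1+L₀
  with power-bracket d (suc L₀) (≮⇒≥ M≮B^1+L₀) (subst (λ e → M < B ^ e) (+-suc L₀ d) hi)
...   | L , 1+L₀≤L , bracket = L , ≤-trans (n≤1+n L₀) 1+L₀≤L , bracket

∃-power-bracket : ∀ {B M} .{{_ : NonZero B}} → 1 < B → ∀ L₀ → B ^ L₀ ≤ M →
  ∃[ L ] (L₀ ≤ L × B ^ L ≤ M × M < B ^ suc L)
∃-power-bracket {B} {M} 1<B L₀ lo =
  power-bracket M L₀ lo (<-≤-trans (n<m^n 1<B M) (^-monoʳ-≤ B (m≤n+m M L₀)))

twice-digitSquareSumBound<power-base : ∀ k → let B = 2 + k; n = expo B in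
  digitSquareSumBound k (suc n) + digitSquareSumBound k (suc n) < B ^ n
twice-digitSquareSumBound<power-base 0 = <ᵇ⇒< 10 16 _
twice-digitSquareSumBound<power-base 1 = <ᵇ⇒< 40 81 _
twice-digitSquareSumBound<power-base 2 = <ᵇ⇒< 90 256 _
twice-digitSquareSumBound<power-base 3 = <ᵇ⇒< 160 625 _
twice-digitSquareSumBound<power-base 4 = <ᵇ⇒< 250 1296 _
-- B = 7 + s, for which n = 3
twice-digitSquareSumBound<power-base (suc (suc (suc (suc (suc s))))) =
  subst (bound + bound <_) (cube-gap s) (m<m+n (bound + bound) (s≤s z≤n))
  where
  bound : ℕ
  bound = 4 * ((6 + s) * (6 + s))
  cube-gap : ∀ s → 4 * ((6 + s) * (6 + s)) + 4 * ((6 + s) * (6 + s))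
                   + suc (54 + 51 * s + 13 * (s * s) + s * (s * s))
                 ≡ (7 + s) * ((7 + s) * ((7 + s) * 1))
  cube-gap = solve-∀

twice-digitSquareSumBound<power-step : ∀ k L →
  digitSquareSumBound k (suc L) + digitSquareSumBound k (suc L) < (2 + k) ^ L →
  digitSquareSumBound k (2 + L) + digitSquareSumBound k (2 + L) < (2 + k) ^ suc L
twice-digitSquareSumBound<power-step k L ih = begin-strict
  b (2 + L) + b (2 + L)
    ≤⟨ +-mono-≤ b[2+L]≤2b[1+L] b[2+L]≤2b[1+L] ⟩
  (b (suc L) + b (suc L)) + (b (suc L) + b (suc L))
    <⟨ +-mono-< ih ih ⟩
  (2 + k) ^ L + (2 + k) ^ L
    ≤⟨ +-monoʳ-≤ ((2 + k) ^ L) (m≤m+n ((2 + k) ^ L) _) ⟩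
  (2 + k) ^ suc L
    ∎
  where
  open ≤-Reasoning
  b : ℕ → ℕ
  b = digitSquareSumBound k
  b[2+L]≤2b[1+L] : b (2 + L) ≤ b (suc L) + b (suc L)
  b[2+L]≤2b[1+L] = +-monoˡ-≤ (b (suc L)) (m≤m+n (suc k * suc k) (L * (suc k * suc k)))

twice-digitSquareSumBound<power : ∀ k L → expo (2 + k) ≤ L →
  digitSquareSumBound k (suc L) + digitSquareSumBound k (suc L) < (2 + k) ^ L
twice-digitSquareSumBound<power k L n≤L with m≤n⇒∃[o]m+o≡n n≤L
... | d , refl = above-base d
  where
  n : ℕ
  n = expo (2 + k)
  above-base : ∀ d →
    digitSquareSumBound k (suc (n + d)) + digitSquareSumBound k (suc (n + d)) < (2 + k) ^ (n + d)
  above-base zero    rewrite +-identityʳ n = twice-digitSquareSumBound<power-base k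
  above-base (suc d) rewrite +-suc n d = twice-digitSquareSumBound<power-step k (n + d) (above-base d)

height-S< : ∀ k g → (2 + k) ^ expo (2 + k) ≤ height g → height (S (2 + k) g) < height g
height-S< k g B^n≤height
  with ∃-power-bracket (s≤s (s≤s z≤n)) (expo (2 + k)) B^n≤height
... | L , n≤L , B^L≤height , height<B^1+L = begin-strict
  height (S B g)
    ≤⟨ height-S≤ B g ⟩
  digitSquareSum B ∣ re g ∣ + digitSquareSum B ∣ im g ∣
    ≤⟨ +-mono-≤ (part≤ (m≤m⊔n ∣ re g ∣ ∣ im g ∣)) (part≤ (m≤n⊔m ∣ re g ∣ ∣ im g ∣)) ⟩
  digitSquareSumBound k (suc L) + digitSquareSumBound k (suc L)
    <⟨ twice-digitSquareSumBound<power k L n≤L ⟩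
  B ^ L
    ≤⟨ B^L≤height ⟩
  height g
    ∎
  where
  open ≤-Reasoning
  B : ℕ
  B = 2 + k
  part≤ : ∀ {m} → m ≤ height g → digitSquareSum B m ≤ digitSquareSumBound k (suc L)
  part≤ {m} m≤height = sumOfSquares-digitsFuel≤ k (suc L) m m (≤-<-trans m≤height height<B^1+L)

module _ (f : ℤ[i] → ℤ[i]) (μ : ℤ[i] → ℕ) (t : ℕ)
         (μ-decreasing : ∀ g → t ≤ μ g → μ (f g) < μ g) where

  μ-iter-decreasing : ∀ g k → (∀ {j} → j < suc k → t ≤ μ (iter j f g)) →
    μ (iter (suc k) f g) < μ g
  μ-iter-decreasing g zero    above = μ-decreasing g (above (s≤s z≤n))
  μ-iter-decreasing g (suc k) above =
    <-trans (μ-decreasing _ (above ≤-refl)) (μ-iter-decreasing g k (above ∘ m<n⇒m<1+n))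

  cycle-meets-μ< : ∀ g k → 1 ≤ k → iter k f g ≡ g → ∃[ j ] (j < k × μ (iter j f g) < t)
  cycle-meets-μ< g (suc k) _ cycle with anyUpTo? (λ j → μ (iter j f g) <? t) (suc k)
  ... | yes found = found
  ... | no  none  = ⊥-elim (<-irrefl (cong μ cycle) (μ-iter-decreasing g k above))
    where
    above : ∀ {j} → j < suc k → t ≤ μ (iter j f g)
    above j<1+k = ≮⇒≥ (λ below → none (_ , j<1+k , below))

corollary5 : (B : ℕ) → 2 ≤ B →
    ((g₀ : ℤ[i]) (k : ℕ) → 1 ≤ k → iter k (S B) g₀ ≡ g₀ →
      ∃[ j ] (j < k × ∣ re (iter j (S B) g₀) ∣ < B ^ expo B
                    × ∣ im (iter j (S B) g₀) ∣ < B ^ expo B))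
    × ((g : ℤ[i]) → S B g ≡ g →
      ∣ re g ∣ < B ^ expo B × ∣ im g ∣ < B ^ expo B)
corollary5 B@(suc (suc b)) (s≤s (s≤s z≤n)) = cycles , fixedPoints
  where
  parts< : ∀ g → height g < B ^ expo B → ∣ re g ∣ < B ^ expo B × ∣ im g ∣ < B ^ expo B
  parts< g h< = m⊔n<o⇒m<o _ _ h< , m⊔n<o⇒n<o _ _ h<

  cycles : (g₀ : ℤ[i]) (k : ℕ) → 1 ≤ k → iter k (S B) g₀ ≡ g₀ →
    ∃[ j ] (j < k × ∣ re (iter j (S B) g₀) ∣ < B ^ expo B × ∣ im (iter j (S B) g₀) ∣ < B ^ expo B)
  cycles g₀ k 1≤k cycle with cycle-meets-μ< (S B) height (B ^ expo B) (height-S< b) g₀ k 1≤k cycle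
  ... | j , j<k , height< = j , j<k , parts< (iter j (S B) g₀) height<

  fixedPoints : (g : ℤ[i]) → S B g ≡ g → ∣ re g ∣ < B ^ expo B × ∣ im g ∣ < B ^ expo B
  fixedPoints g fixed with cycles g 1 ≤-refl fixed
  ... | zero  , _      , parts = parts
  ... | suc _ , s≤s () , _
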